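{- For every graph $G$, $\chi_{\mu_i}(G)\le \chi(G)\,\chi_\mu(G)$. This bound is sharp; e.g., equality holds for every complete graph $K_n$.
   Context: All graphs are finite and simple. $\chi(G)$ is the chromatic number. A geodesic is a shortest path. For $X\subseteq V(G)$, two vertices $x,y\in X$ are $X$-visible if some $x,y$-geodesic has no internal vertex in $X$. $X$ is a mutual-visibility (MV) set if every two of its vertices are $X$-visible, and an independent mutual-visibility (IMV) set if moreover it is independent. $\chi_\mu(G)$ (resp. $\chi_{\mu_i}(G)$) is the least $k$ such that $V(G)$ can be partitioned into $k$ MV sets (resp. IMV sets). -}

module Defs where

open import Data.Nat using (ℕ; zero; suc; _≤_)
open import Data.Fin using (Fin)
open import Data.Bool using (Bool; true; false)
open import Data.Product using (Σ; ∃; _×_; _,_)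
open import Data.Unit using (⊤)
open import Relation.Nullary using (¬_)
open import Relation.Binary.PropositionalEquality using (_≡_; _≢_)

record Graph (n : ℕ) : Set where
  field
    adj     : Fin n → Fin n → Bool
    adj-sym : ∀ u v → adj u v ≡ adj v u
    adj-irr : ∀ v → adj v v ≡ false
open Graph public

Adj : ∀ {n} → Graph n → Fin n → Fin n → Set
Adj G u v = adj G u v ≡ true

data Walk {n : ℕ} (G : Graph n) : Fin n → Fin n → ℕ → Set where
  []   : ∀ {x} → Walk G x x 0
  step : ∀ {x y z k} → Adj G x y → Walk G y z k → Walk G x z (suc k)

IsGeodesic : ∀ {n} {G : Graph n} {x y k} → Walk G x y k → Set
IsGeodesic {G = G} {x} {y} {k} _ = ∀ j → Walk G x y j → k ≤ j

AvoidButLast : ∀ {n} {G : Graph n} (X : Fin n → Set) {x y k} → Walk G x y k → Set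
AvoidButLast X []                  = ⊤
AvoidButLast X (step {x = x} _ w)  = ¬ X x × AvoidButLast X w

NoInternalIn : ∀ {n} {G : Graph n} (X : Fin n → Set) {x y k} → Walk G x y k → Set
NoInternalIn X []         = ⊤
NoInternalIn X (step _ w) = AvoidButLast X w

Visible : ∀ {n} (G : Graph n) (X : Fin n → Set) → Fin n → Fin n → Set
Visible G X x y =
  Σ ℕ λ k → Σ (Walk G x y k) λ w → IsGeodesic w × NoInternalIn X w

IsMV : ∀ {n} (G : Graph n) (X : Fin n → Set) → Set
IsMV G X = ∀ x y → X x → X y → Visible G X x y

IsIndependent : ∀ {n} (G : Graph n) (X : Fin n → Set) → Set
IsIndependent G X = ∀ x y → X x → X y → ¬ Adj G x y

IsIMV : ∀ {n} (G : Graph n) (X : Fin n → Set) → Set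
IsIMV G X = IsIndependent G X × IsMV G X

Class : ∀ {n k} → (Fin n → Fin k) → Fin k → Fin n → Set
Class c i v = c v ≡ i

-- A partition of V(G) into k (possibly empty) parts, given as a map to Fin k,
-- such that every part satisfies P.  (Empty parts are harmless: the empty set
-- is independent and MV, so the least k is the same as for partitions.)
PartitionInto : ∀ {n} (G : Graph n) (P : (Fin n → Set) → Set) → ℕ → Set
PartitionInto G P k = Σ (Fin _ → Fin k) λ c → ∀ i → P (Class c i)

ProperColourable : ∀ {n} → Graph n → ℕ → Set
ProperColourable G = PartitionInto G (IsIndependent G)

MVColourable : ∀ {n} → Graph n → ℕ → Set
MVColourable G = PartitionInto G (IsMV G)

IMVColourable : ∀ {n} → Graph n → ℕ → Set
IMVColourable G = PartitionInto G (IsIMV G)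

IsLeast : (ℕ → Set) → ℕ → Set
IsLeast P k = P k × (∀ j → P j → k ≤ j)

IsChromaticNumber : ∀ {n} → Graph n → ℕ → Set
IsChromaticNumber G = IsLeast (ProperColourable G)

IsMVChromaticNumber : ∀ {n} → Graph n → ℕ → Set
IsMVChromaticNumber G = IsLeast (MVColourable G)

IsIMVChromaticNumber : ∀ {n} → Graph n → ℕ → Set
IsIMVChromaticNumber G = IsLeast (IMVColourable G)

open import Data.Fin using (_≟_)
open import Relation.Nullary using (yes; no)
open import Relation.Binary.PropositionalEquality using (refl; sym)

completeAdj : ∀ {n} → Fin n → Fin n → Bool
completeAdj u v with u ≟ v
... | yes _ = false
... | no  _ = true

private
  completeSym : ∀ {n} (u v : Fin n) → completeAdj u v ≡ completeAdj v u
  completeSym u v with u ≟ v | v ≟ u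
  ... | yes _ | yes _ = refl
  ... | yes p | no q  with q (sym p)
  ... | ()
  completeSym u v | no p | yes q with p (sym q)
  ... | ()
  completeSym u v | no _ | no _ = refl

  completeIrr : ∀ {n} (v : Fin n) → completeAdj v v ≡ false
  completeIrr v with v ≟ v
  ... | yes _ = refl
  ... | no p with p refl
  ... | ()

K : (n : ℕ) → Graph n
K n = record { adj = completeAdj ; adj-sym = completeSym ; adj-irr = completeIrr }

{-# OPTIONS --safe #-}
-- Independence and mutual visibility are both inherited by subsets: a geodesic
-- with no internal vertex in X has none in any Y ⊆ X. Hence the common
-- refinement of a proper χ-colouring and a partition into χ_μ mutual-visibility
-- sets is a partition into χ·χ_μ independent mutual-visibility sets. In K_n every
-- proper colouring is injective, while every vertex set is mutual-visibility
-- (any two vertices are at distance ≤ 1), so χ = χ_{μ_i} = n and χ_μ = 1 for n ≥ 1.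
module Submission where

open import Defs
open import Data.Nat using (ℕ; zero; suc; _≤_; _*_; z≤n; s≤s)
open import Data.Nat.Properties using (≤-antisym; *-identityʳ)
open import Data.Fin using (Fin; combine; remQuot; _≟_)
open import Data.Fin.Properties using (remQuot-combine; injective⇒≤)
open import Data.Product using (_×_; _,_; proj₁; proj₂)
open import Data.Unit using (tt)
open import Data.Empty using (⊥-elim)
open import Function using (id; _∘_)
open import Function.Definitions using (Injective)
open import Relation.Nullary using (¬_; yes; no)
open import Relation.Unary using (_⊆_)
open import Relation.Binary.PropositionalEquality using (_≡_; _≢_; refl; sym; trans; cong)

Hereditary : ∀ {n} → ((Fin n → Set) → Set) → Set₁
Hereditary P = ∀ {X Y} → Y ⊆ X → P X → P Y

avoidButLast-antimono : ∀ {n} {G : Graph n} {X Y : Fin n → Set} → Y ⊆ X →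
  ∀ {x y k} (w : Walk G x y k) → AvoidButLast X w → AvoidButLast Y w
avoidButLast-antimono Y⊆X []         tt          = tt
avoidButLast-antimono Y⊆X (step _ w) (x∉X , w∉X) = x∉X ∘ Y⊆X , avoidButLast-antimono Y⊆X w w∉X

noInternalIn-antimono : ∀ {n} {G : Graph n} {X Y : Fin n → Set} → Y ⊆ X →
  ∀ {x y k} (w : Walk G x y k) → NoInternalIn X w → NoInternalIn Y w
noInternalIn-antimono Y⊆X []         tt = tt
noInternalIn-antimono Y⊆X (step _ w) w∉X = avoidButLast-antimono Y⊆X w w∉X

visible-antimono : ∀ {n} {G : Graph n} {X Y : Fin n → Set} → Y ⊆ X →
  ∀ {x y} → Visible G X x y → Visible G Y x y
visible-antimono Y⊆X (k , w , geo , w∉X) = k , w , geo , noInternalIn-antimono Y⊆X w w∉X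

isMV-hereditary : ∀ {n} (G : Graph n) → Hereditary (IsMV G)
isMV-hereditary G Y⊆X mvX x y x∈Y y∈Y = visible-antimono Y⊆X (mvX x y (Y⊆X x∈Y) (Y⊆X y∈Y))

isIndependent-hereditary : ∀ {n} (G : Graph n) → Hereditary (IsIndependent G)
isIndependent-hereditary G Y⊆X indX x y x∈Y y∈Y = indX x y (Y⊆X x∈Y) (Y⊆X y∈Y)

class-combine⊆classˡ : ∀ {n a b} (f : Fin n → Fin a) (g : Fin n → Fin b) (i : Fin (a * b)) →
  Class (λ v → combine (f v) (g v)) i ⊆ Class f (proj₁ (remQuot {a} b i))
class-combine⊆classˡ f g i {v} refl = cong proj₁ (sym (remQuot-combine (f v) (g v)))

class-combine⊆classʳ : ∀ {n a b} (f : Fin n → Fin a) (g : Fin n → Fin b) (i : Fin (a * b)) →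
  Class (λ v → combine (f v) (g v)) i ⊆ Class g (proj₂ (remQuot {a} b i))
class-combine⊆classʳ f g i {v} refl = cong proj₂ (sym (remQuot-combine (f v) (g v)))

partitionInto-× : ∀ {n} {G : Graph n} {P Q : (Fin n → Set) → Set} {a b} →
  Hereditary P → Hereditary Q →
  PartitionInto G P a → PartitionInto G Q b → PartitionInto G (λ X → P X × Q X) (a * b)
partitionInto-× hereditaryP hereditaryQ (f , f-P) (g , g-Q) =
  (λ v → combine (f v) (g v)) ,
  λ i → hereditaryP (class-combine⊆classˡ f g i) (f-P _) ,
        hereditaryQ (class-combine⊆classʳ f g i) (g-Q _)

χμi≤χ*χμ : ∀ {n} (G : Graph n) {a b c} →
  IsChromaticNumber G a → IsMVChromaticNumber G b → IsIMVChromaticNumber G c → c ≤ a * b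
χμi≤χ*χμ G {a} {b} (colouring , _) (mvPartition , _) (_ , minimal) =
  minimal (a * b) (partitionInto-× {G = G} {P = IsIndependent G} {Q = IsMV G}
    (isIndependent-hereditary G) (isMV-hereditary G) colouring mvPartition)

isLeast-unique : ∀ {P : ℕ → Set} {k m} → IsLeast P k → IsLeast P m → k ≡ m
isLeast-unique (Pk , k-least) (Pm , m-least) = ≤-antisym (k-least _ Pm) (m-least _ Pk)

adj-irreflexive : ∀ {n} (G : Graph n) {v} → ¬ Adj G v v
adj-irreflexive G {v} v~v with () ← trans (sym v~v) (adj-irr G v)

visible-refl : ∀ {n} {G : Graph n} {X : Fin n → Set} {x} → Visible G X x x
visible-refl = 0 , [] , (λ _ _ → z≤n) , tt

adjacent⇒visible : ∀ {n} {G : Graph n} {X : Fin n → Set} {x y} → Adj G x y → Visible G X x y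
adjacent⇒visible {G = G} {x = x} x~y = 1 , step x~y [] , geodesic , tt
  where
  geodesic : ∀ j → Walk G x _ j → 1 ≤ j
  geodesic zero    [] = ⊥-elim (adj-irreflexive G x~y)
  geodesic (suc j) _  = s≤s z≤n

singletons-isIMV : ∀ {n} (G : Graph n) (i : Fin n) → IsIMV G (Class id i)
singletons-isIMV G i = (λ { x .x refl refl → adj-irreflexive G }) , λ { x .x refl refl → visible-refl }

K-adj : ∀ {n} {x y : Fin n} → x ≢ y → Adj (K n) x y
K-adj {x = x} {y} x≢y with x ≟ y
... | yes x≡y = ⊥-elim (x≢y x≡y)
... | no  _   = refl

K-isMV : ∀ {n} (X : Fin n → Set) → IsMV (K n) X
K-isMV X x y _ _ with x ≟ y
... | yes refl = visible-refl
... | no  x≢y  = adjacent⇒visible (K-adj x≢y)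

K-properColouring-injective : ∀ {n k} {f : Fin n → Fin k} →
  (∀ i → IsIndependent (K n) (Class f i)) → Injective _≡_ _≡_ f
K-properColouring-injective {f = f} proper {x} {y} fx≡fy with x ≟ y
... | yes x≡y = x≡y
... | no  x≢y = ⊥-elim (proper (f x) x y refl (sym fx≡fy) (K-adj x≢y))

K-colourable⇒n≤ : ∀ {n k} → ProperColourable (K n) k → n ≤ k
K-colourable⇒n≤ (f , proper) = injective⇒≤ (K-properColouring-injective proper)

K-χ : ∀ n → IsChromaticNumber (K n) n
K-χ n = (id , proj₁ ∘ singletons-isIMV (K n)) , λ _ → K-colourable⇒n≤

K-χμi : ∀ n → IsIMVChromaticNumber (K n) n
K-χμi n = (id , singletons-isIMV (K n)) ,
          λ { _ (f , imv) → K-colourable⇒n≤ (f , proj₁ ∘ imv) }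

K-χμ : ∀ m → IsMVChromaticNumber (K (suc m)) 1
K-χμ m = ((λ _ → Fin.zero) , λ _ → K-isMV _) , least
  where
  least : ∀ j → MVColourable (K (suc m)) j → 1 ≤ j
  least (suc _) _ = s≤s z≤n
  least zero (g , _) with () ← g Fin.zero

K-χμi≡χ*χμ : ∀ n {a b c} →
  IsChromaticNumber (K n) a → IsMVChromaticNumber (K n) b → IsIMVChromaticNumber (K n) c → c ≡ a * b
K-χμi≡χ*χμ n {a} {b} {c} χ≡a χμ≡b χμi≡c
  rewrite isLeast-unique χ≡a (K-χ n) | isLeast-unique χμi≡c (K-χμi n) = n≡n*b n χμ≡b
  where
  n≡n*b : ∀ n → IsMVChromaticNumber (K n) b → n ≡ n * b
  n≡n*b zero    _    = refl
  n≡n*b (suc m) χμ≡b rewrite isLeast-unique χμ≡b (K-χμ m) = sym (*-identityʳ (suc m))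

proposition4p3 :
    ((n : ℕ) (G : Graph n) (a b c : ℕ) →
      IsChromaticNumber G a → IsMVChromaticNumber G b → IsIMVChromaticNumber G c →
      c ≤ a * b)
    × ((n a b c : ℕ) →
      IsChromaticNumber (K n) a → IsMVChromaticNumber (K n) b → IsIMVChromaticNumber (K n) c →
      c ≡ a * b)
proposition4p3 = (λ n G a b c → χμi≤χ*χμ G) , λ n a b c → K-χμi≡χ*χμ n
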